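{- Let $\alpha$ be an indeterminate and $\mathsf L^{(\alpha)}=(\ell_{n,k})_{n,k\ge0}$ with $\ell_{n,k}=\binom{n}{k}(n+\alpha)^{\underline{n-k}}$ for $0\le k\le n$ and $0$ otherwise. Then $\mathsf L^{(\alpha)}$ equals the matrix $(S_{n,\ell}(\boldsymbol\beta))_{n,\ell\ge0}$ of generalized Stieltjes--Rogers polynomials of the first kind corresponding to the weights $\beta_{2k-1}=k+\alpha$ and $\beta_{2k}=k$ ($k\ge1$).
   Context: $\rho^{\underline m}=\rho(\rho-1)\cdots(\rho-m+1)$. Given weights $\boldsymbol\beta=(\beta_i)_{i\ge1}$, a partial Dyck path is a path in $\mathbb Z\times\mathbb N$ with steps $(1,1)$ (rises) and $(1,-1)$ (falls) starting on the horizontal axis. $S_{n,\ell}(\boldsymbol\beta)$ is the sum, over partial Dyck paths from $(0,0)$ to $(2n,2\ell)$, of the product of the weights of the steps, where each rise has weight $1$ and each fall from height $i$ has weight $\beta_i$. -}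

module Defs where

open import Level using (Level)
open import Algebra.Bundles using (CommutativeRing)
open import Data.Nat as ℕ using (ℕ; zero; suc; _≤?_; _≟_; _∸_)
open import Data.Nat.Combinatorics using (_C_)
open import Data.List using (List; []; _∷_; map; concatMap)
open import Relation.Nullary using (yes; no)

-- Steps of a path: rise (1,1) or fall (1,-1).
data Step : Set where
  rise fall : Step

allSteps : ℕ → List (List Step)
allSteps zero    = [] ∷ []
allSteps (suc m) = concatMap (λ s → (rise ∷ s) ∷ (fall ∷ s) ∷ []) (allSteps m)

module _ {c ℓ : Level} (R : CommutativeRing c ℓ) where
  open CommutativeRing R

  ofℕ : ℕ → Carrier
  ofℕ zero    = 0#
  ofℕ (suc n) = 1# + ofℕ n

  falling : Carrier → ℕ → Carrier
  falling ρ zero    = 1#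
  falling ρ (suc m) = falling ρ m * (ρ + (- ofℕ m))

  lagEntry : Carrier → ℕ → ℕ → Carrier
  lagEntry α n k with k ≤? n
  ... | yes _ = ofℕ (n C k) * falling (ofℕ n + α) (n ∸ k)
  ... | no  _ = 0#

  -- Rises weigh 1, a fall from
  -- height i weighs β i.  Sequences that are not partial Dyck paths from
  -- height h to height t get weight 0.
  pathWeight : (ℕ → Carrier) → ℕ → ℕ → List Step → Carrier
  pathWeight β t h [] with h ≟ t
  ... | yes _ = 1#
  ... | no  _ = 0#
  pathWeight β t h (rise ∷ s)       = pathWeight β t (suc h) s
  pathWeight β t zero (fall ∷ s)    = 0#
  pathWeight β t (suc h) (fall ∷ s) = β (suc h) * pathWeight β t h s

  sumR : List Carrier → Carrier
  sumR []       = 0#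
  sumR (x ∷ xs) = x + sumR xs

  S : (ℕ → Carrier) → ℕ → ℕ → Carrier
  S β n l = sumR (map (pathWeight β (2 ℕ.* l) 0) (allSteps (2 ℕ.* n)))

{-# OPTIONS --safe #-}
module Submission where

-- Both matrices satisfy the three-term row recurrence
--   X (n+1) l = X n (l-1) + γ_l X n l + δ_l X n (l+1),  γ_l = 2l+1+α,  δ_l = (l+1)(l+1+α),
-- and have the same row 0, so they coincide.  For S this is the even contraction: splitting
-- off the last two steps of a path of length 2n+2 ending at height 2l gives
-- γ_l = β_{2l} + β_{2l+1} and δ_l = β_{2l+1} β_{2l+2}.  For ℓ_{n,k} it follows from Pascal's
-- rule, the absorption identity (n-k) C(n,k) = (k+1) C(n,k+1), and peeling one factor off the
-- falling factorial (n+α)^{\underline{n-k}}.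

open import Defs
open import Level using (Level)
open import Algebra.Bundles using (CommutativeRing)
open import Data.Nat as ℕ using (ℕ; zero; suc; _≤_; _<_; z≤n; s≤s)
import Data.Nat.Properties as ℕ
open import Data.Nat.Combinatorics using (_C_; nCn≡1; nCk+nC[k+1]≡[n+1]C[k+1])
open import Data.List using (List; []; _∷_; _∷ʳ_; map; concatMap)
open import Relation.Nullary using (yes; no)
open import Relation.Binary.PropositionalEquality as ≡ using (_≡_)
open import Relation.Binary.Definitions using (tri<; tri≈; tri>)
open import Data.Empty using (⊥-elim)
open import Data.Sum using (inj₁; inj₂)

module Binomial where
  open import Data.Nat
  open import Data.Nat.Properties
  open import Data.Nat.Combinatorics
  open import Relation.Binary.PropositionalEquality
  open import Data.Nat.Solver using (module +-*-Solver)
  open +-*-Solver using (solve; _:+_; _:*_; _:=_; con)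

  private
    -- When j ≥ n the coefficient n C (j+1) vanishes; otherwise the two weights agree.
    rebalance : ∀ n j → suc j * (n C suc j) + (n ∸ j) * (n C suc j)
                      ≡ suc (suc j) * (n C suc j) + (n ∸ suc j) * (n C suc j)
    rebalance n j with j <? n
    ... | yes j<n rewrite +-∸-assoc 1 j<n =
      solve 3 (λ j d c → (con 1 :+ j) :* c :+ (con 1 :+ d) :* c := (con 2 :+ j) :* c :+ d :* c)
            refl j (n ∸ suc j) (n C suc j)
    ... | no j≮n rewrite k>n⇒nCk≡0 {n} {suc j} (s≤s (≮⇒≥ j≮n)) =
      trans (cong₂ _+_ (*-zeroʳ (suc j)) (*-zeroʳ (n ∸ j)))
            (sym (cong₂ _+_ (*-zeroʳ (suc (suc j))) (*-zeroʳ (n ∸ suc j))))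

  [n∸k]*nCk≡[k+1]*nC[k+1] : ∀ n k → (n ∸ k) * (n C k) ≡ suc k * (n C suc k)
  [n∸k]*nCk≡[k+1]*nC[k+1] zero    zero    = refl
  [n∸k]*nCk≡[k+1]*nC[k+1] zero    (suc k) = sym (*-zeroʳ (suc (suc k)))
  [n∸k]*nCk≡[k+1]*nC[k+1] (suc n) zero    =
    trans (*-identityʳ (suc n)) (sym (trans (+-identityʳ _) (nC1≡n (suc n))))
  [n∸k]*nCk≡[k+1]*nC[k+1] (suc n) (suc j) = begin
    (n ∸ j) * (suc n C suc j)
      ≡⟨ cong ((n ∸ j) *_) (nCk+nC[k+1]≡[n+1]C[k+1] n j) ⟨
    (n ∸ j) * (n C j + n C suc j)
      ≡⟨ *-distribˡ-+ (n ∸ j) (n C j) (n C suc j) ⟩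
    (n ∸ j) * (n C j) + (n ∸ j) * (n C suc j)
      ≡⟨ cong (_+ (n ∸ j) * (n C suc j)) ([n∸k]*nCk≡[k+1]*nC[k+1] n j) ⟩
    suc j * (n C suc j) + (n ∸ j) * (n C suc j)
      ≡⟨ rebalance n j ⟩
    suc (suc j) * (n C suc j) + (n ∸ suc j) * (n C suc j)
      ≡⟨ cong (suc (suc j) * (n C suc j) +_) ([n∸k]*nCk≡[k+1]*nC[k+1] n (suc j)) ⟩
    suc (suc j) * (n C suc j) + suc (suc j) * (n C suc (suc j))
      ≡⟨ *-distribˡ-+ (suc (suc j)) (n C suc j) (n C suc (suc j)) ⟨
    suc (suc j) * (n C suc j + n C suc (suc j))
      ≡⟨ cong (suc (suc j) *_) (nCk+nC[k+1]≡[n+1]C[k+1] n (suc j)) ⟩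
    suc (suc j) * (suc n C suc (suc j))
      ∎
    where open ≡-Reasoning

open Binomial using ([n∸k]*nCk≡[k+1]*nC[k+1])

module _ {c ℓ : Level} (R : CommutativeRing c ℓ) where
  open CommutativeRing R
  open import Algebra.Solver.Ring.NaturalCoefficients.Default commutativeSemiring
    using (solve; _:=_; _:+_; _:*_)
  open import Relation.Binary.Reasoning.Setoid setoid
  open import Algebra.Properties.CommutativeSemigroup *-commutativeSemigroup using (x∙yz≈y∙xz)
  open import Algebra.Properties.AbelianGroup +-abelianGroup using (xyx⁻¹≈y; ⁻¹-∙-comm; ε⁻¹≈ε)
  open import Algebra.Properties.Semiring.Mult semiring using (_×_; ×-homo-+; ×1-homo-*)

  sumR-map-cong : ∀ {a} {A : Set a} {F G : A → Carrier} xs →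
                  (∀ x → F x ≈ G x) → sumR R (map F xs) ≈ sumR R (map G xs)
  sumR-map-cong []       F≈G = refl
  sumR-map-cong (x ∷ xs) F≈G = +-cong (F≈G x) (sumR-map-cong xs F≈G)

  sumR-map-*ˡ : ∀ {a} {A : Set a} y (F : A → Carrier) xs →
                sumR R (map (λ x → y * F x) xs) ≈ y * sumR R (map F xs)
  sumR-map-*ˡ y F []       = sym (zeroʳ y)
  sumR-map-*ˡ y F (x ∷ xs) = trans (+-congˡ (sumR-map-*ˡ y F xs)) (sym (distribˡ y (F x) _))

  sumR-map-≈0 : ∀ {a} {A : Set a} {F : A → Carrier} xs →
                (∀ x → F x ≈ 0#) → sumR R (map F xs) ≈ 0#
  sumR-map-≈0 []       F≈0 = refl
  sumR-map-≈0 (x ∷ xs) F≈0 = trans (+-cong (F≈0 x) (sumR-map-≈0 xs F≈0)) (+-identityʳ 0#)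

  sumSteps : ℕ → (List Step → Carrier) → Carrier
  sumSteps m F = sumR R (map F (allSteps m))

  private
    interchange : ∀ a b c d → (a + b) + (c + d) ≈ (a + c) + (b + d)
    interchange = solve 4 (λ a b c d → (a :+ b) :+ (c :+ d) := (a :+ c) :+ (b :+ d)) refl

    sumR-extend : ∀ (F : List Step → Carrier) xs →
      sumR R (map F (concatMap (λ s → (rise ∷ s) ∷ (fall ∷ s) ∷ []) xs))
        ≈ sumR R (map (λ s → F (rise ∷ s)) xs) + sumR R (map (λ s → F (fall ∷ s)) xs)
    sumR-extend F []       = sym (+-identityʳ 0#)
    sumR-extend F (s ∷ xs) =
      trans (+-congˡ (+-congˡ (sumR-extend F xs)))
            (solve 4 (λ a b p q → a :+ (b :+ (p :+ q)) := (a :+ p) :+ (b :+ q)) refl _ _ _ _)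

  sumSteps-suc : ∀ m F →
    sumSteps (suc m) F ≈ sumSteps m (λ s → F (rise ∷ s)) + sumSteps m (λ s → F (fall ∷ s))
  sumSteps-suc m F = sumR-extend F (allSteps m)

  sumSteps-suc-∷ʳ : ∀ m F →
    sumSteps (suc m) F ≈ sumSteps m (λ s → F (s ∷ʳ rise)) + sumSteps m (λ s → F (s ∷ʳ fall))
  sumSteps-suc-∷ʳ zero    F =
    trans (+-congˡ (+-identityʳ _)) (sym (+-cong (+-identityʳ _) (+-identityʳ _)))
  sumSteps-suc-∷ʳ (suc m) F = begin
    sumSteps (suc (suc m)) F
      ≈⟨ sumSteps-suc (suc m) F ⟩
    sumSteps (suc m) (λ s → F (rise ∷ s)) + sumSteps (suc m) (λ s → F (fall ∷ s))
      ≈⟨ +-cong (sumSteps-suc-∷ʳ m _) (sumSteps-suc-∷ʳ m _) ⟩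
    (sumSteps m (λ s → F (rise ∷ s ∷ʳ rise)) + sumSteps m (λ s → F (rise ∷ s ∷ʳ fall)))
      + (sumSteps m (λ s → F (fall ∷ s ∷ʳ rise)) + sumSteps m (λ s → F (fall ∷ s ∷ʳ fall)))
      ≈⟨ interchange _ _ _ _ ⟩
    (sumSteps m (λ s → F (rise ∷ s ∷ʳ rise)) + sumSteps m (λ s → F (fall ∷ s ∷ʳ rise)))
      + (sumSteps m (λ s → F (rise ∷ s ∷ʳ fall)) + sumSteps m (λ s → F (fall ∷ s ∷ʳ fall)))
      ≈⟨ +-cong (sumSteps-suc m _) (sumSteps-suc m _) ⟨
    sumSteps (suc m) (λ s → F (s ∷ʳ rise)) + sumSteps (suc m) (λ s → F (s ∷ʳ fall)) ∎

  jacobiStep : (γ δ f : ℕ → Carrier) → ℕ → Carrier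
  jacobiStep γ δ f zero    = γ 0 * f 0 + δ 0 * f 1
  jacobiStep γ δ f (suc l) = f l + (γ (suc l) * f (suc l) + δ (suc l) * f (suc (suc l)))

  jacobiStep-cong : ∀ {γ γ′ δ δ′ f g : ℕ → Carrier} →
                    (∀ l → γ l ≈ γ′ l) → (∀ l → δ l ≈ δ′ l) → (∀ l → f l ≈ g l) →
                    ∀ l → jacobiStep γ δ f l ≈ jacobiStep γ′ δ′ g l
  jacobiStep-cong γ≈γ′ δ≈δ′ f≈g zero    =
    +-cong (*-cong (γ≈γ′ 0) (f≈g 0)) (*-cong (δ≈δ′ 0) (f≈g 1))
  jacobiStep-cong γ≈γ′ δ≈δ′ f≈g (suc l) =
    +-cong (f≈g l) (+-cong (*-cong (γ≈γ′ (suc l)) (f≈g (suc l)))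
                           (*-cong (δ≈δ′ (suc l)) (f≈g (suc (suc l)))))

  jacobiRows-unique : ∀ {γ γ′ δ δ′ : ℕ → Carrier} {X Y : ℕ → ℕ → Carrier} →
                      (∀ l → γ l ≈ γ′ l) → (∀ l → δ l ≈ δ′ l) → (∀ l → X 0 l ≈ Y 0 l) →
                      (∀ n l → X (suc n) l ≈ jacobiStep γ δ (X n) l) →
                      (∀ n l → Y (suc n) l ≈ jacobiStep γ′ δ′ (Y n) l) →
                      ∀ n l → X n l ≈ Y n l
  jacobiRows-unique {X = X} {Y} γ≈γ′ δ≈δ′ X₀≈Y₀ X-step Y-step = rows
    where
    rows : ∀ n l → X n l ≈ Y n l
    rows zero    l = X₀≈Y₀ l
    rows (suc n) l =
      trans (X-step n l) (trans (jacobiStep-cong γ≈γ′ δ≈δ′ (rows n) l) (sym (Y-step n l)))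

  module _ (β : ℕ → Carrier) where

    pathWeight-∷ʳ-rise : ∀ t h s →
      pathWeight R β (suc t) h (s ∷ʳ rise) ≈ pathWeight R β t h s
    pathWeight-∷ʳ-rise t h [] with h ℕ.≟ t | suc h ℕ.≟ suc t
    ... | yes _   | yes _   = refl
    ... | no _    | no _    = refl
    ... | yes h≡t | no h≢t  = ⊥-elim (h≢t (≡.cong suc h≡t))
    ... | no h≢t  | yes h≡t = ⊥-elim (h≢t (ℕ.suc-injective h≡t))
    pathWeight-∷ʳ-rise t h       (rise ∷ s) = pathWeight-∷ʳ-rise t (suc h) s
    pathWeight-∷ʳ-rise t zero    (fall ∷ s) = refl
    pathWeight-∷ʳ-rise t (suc h) (fall ∷ s) = *-congˡ (pathWeight-∷ʳ-rise t h s)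

    pathWeight-∷ʳ-rise-zero : ∀ h s → pathWeight R β 0 h (s ∷ʳ rise) ≈ 0#
    pathWeight-∷ʳ-rise-zero h       []         = refl
    pathWeight-∷ʳ-rise-zero h       (rise ∷ s) = pathWeight-∷ʳ-rise-zero (suc h) s
    pathWeight-∷ʳ-rise-zero zero    (fall ∷ s) = refl
    pathWeight-∷ʳ-rise-zero (suc h) (fall ∷ s) =
      trans (*-congˡ (pathWeight-∷ʳ-rise-zero h s)) (zeroʳ _)

    pathWeight-∷ʳ-fall : ∀ t h s →
      pathWeight R β t h (s ∷ʳ fall) ≈ β (suc t) * pathWeight R β (suc t) h s
    pathWeight-∷ʳ-fall t zero [] = sym (zeroʳ _)
    pathWeight-∷ʳ-fall t (suc h) [] with h ℕ.≟ t | suc h ℕ.≟ suc t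
    ... | yes ≡.refl | yes _   = refl
    ... | no _       | no _    = trans (zeroʳ _) (sym (zeroʳ _))
    ... | yes h≡t    | no h≢t  = ⊥-elim (h≢t (≡.cong suc h≡t))
    ... | no h≢t     | yes h≡t = ⊥-elim (h≢t (ℕ.suc-injective h≡t))
    pathWeight-∷ʳ-fall t h       (rise ∷ s) = pathWeight-∷ʳ-fall t (suc h) s
    pathWeight-∷ʳ-fall t zero    (fall ∷ s) = sym (zeroʳ _)
    pathWeight-∷ʳ-fall t (suc h) (fall ∷ s) =
      trans (*-congˡ (pathWeight-∷ʳ-fall t h s)) (x∙yz≈y∙xz (β (suc h)) (β (suc t)) _)

    pathSum : ℕ → ℕ → Carrier
    pathSum m t = sumSteps m (pathWeight R β t 0)

    pathSum-suc-zero : ∀ m → pathSum (suc m) 0 ≈ β 1 * pathSum m 1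
    pathSum-suc-zero m = begin
      pathSum (suc m) 0
        ≈⟨ sumSteps-suc-∷ʳ m (pathWeight R β 0 0) ⟩
      sumSteps m (λ s → pathWeight R β 0 0 (s ∷ʳ rise))
        + sumSteps m (λ s → pathWeight R β 0 0 (s ∷ʳ fall))
        ≈⟨ +-cong (sumR-map-≈0 (allSteps m) (pathWeight-∷ʳ-rise-zero 0))
                  (sumR-map-cong (allSteps m) (pathWeight-∷ʳ-fall 0 0)) ⟩
      0# + sumSteps m (λ s → β 1 * pathWeight R β 1 0 s)
        ≈⟨ +-identityˡ _ ⟩
      sumSteps m (λ s → β 1 * pathWeight R β 1 0 s)
        ≈⟨ sumR-map-*ˡ (β 1) (pathWeight R β 1 0) (allSteps m) ⟩
      β 1 * pathSum m 1 ∎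

    pathSum-suc-suc : ∀ m t →
      pathSum (suc m) (suc t) ≈ pathSum m t + β (suc (suc t)) * pathSum m (suc (suc t))
    pathSum-suc-suc m t = begin
      pathSum (suc m) (suc t)
        ≈⟨ sumSteps-suc-∷ʳ m (pathWeight R β (suc t) 0) ⟩
      sumSteps m (λ s → pathWeight R β (suc t) 0 (s ∷ʳ rise))
        + sumSteps m (λ s → pathWeight R β (suc t) 0 (s ∷ʳ fall))
        ≈⟨ +-cong (sumR-map-cong (allSteps m) (pathWeight-∷ʳ-rise t 0))
                  (sumR-map-cong (allSteps m) (pathWeight-∷ʳ-fall (suc t) 0)) ⟩
      pathSum m t + sumSteps m (λ s → β (suc (suc t)) * pathWeight R β (suc (suc t)) 0 s)
        ≈⟨ +-congˡ (sumR-map-*ˡ _ (pathWeight R β (suc (suc t)) 0) (allSteps m)) ⟩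
      pathSum m t + β (suc (suc t)) * pathSum m (suc (suc t)) ∎

    evenγ : ℕ → Carrier
    evenγ zero    = β 1
    evenγ (suc l) = β (2 ℕ.+ 2 ℕ.* l) + β (1 ℕ.+ 2 ℕ.* suc l)

    evenδ : ℕ → Carrier
    evenδ l = β (1 ℕ.+ 2 ℕ.* l) * β (2 ℕ.+ 2 ℕ.* l)

    S-suc-jacobi : ∀ n l → S R β (suc n) l ≈ jacobiStep evenγ evenδ (S R β n) l
    S-suc-jacobi n zero = begin
      pathSum (2 ℕ.* suc n) 0
        ≡⟨ ≡.cong (λ m → pathSum m 0) (ℕ.*-suc 2 n) ⟩
      pathSum (suc (suc (2 ℕ.* n))) 0
        ≈⟨ pathSum-suc-zero (suc (2 ℕ.* n)) ⟩
      β 1 * pathSum (suc (2 ℕ.* n)) 1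
        ≈⟨ *-congˡ (pathSum-suc-suc (2 ℕ.* n) 0) ⟩
      β 1 * (E 0 + β 2 * E 2)
        ≈⟨ solve 4 (λ b₁ b₂ x y → b₁ :* (x :+ b₂ :* y) := b₁ :* x :+ (b₁ :* b₂) :* y)
                 refl (β 1) (β 2) (E 0) (E 2) ⟩
      β 1 * E 0 + (β 1 * β 2) * E 2
        ∎
      where
      E : ℕ → Carrier
      E = pathSum (2 ℕ.* n)
    S-suc-jacobi n (suc l) = begin
      pathSum (2 ℕ.* suc n) (2 ℕ.* suc l)
        ≡⟨ ≡.cong₂ pathSum (ℕ.*-suc 2 n) (ℕ.*-suc 2 l) ⟩
      pathSum (suc (suc (2 ℕ.* n))) (suc (suc m))
        ≈⟨ pathSum-suc-suc (suc (2 ℕ.* n)) (suc m) ⟩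
      pathSum (suc (2 ℕ.* n)) (suc m) + β (3 ℕ.+ m) * pathSum (suc (2 ℕ.* n)) (3 ℕ.+ m)
        ≈⟨ +-cong (pathSum-suc-suc (2 ℕ.* n) m) (*-congˡ (pathSum-suc-suc (2 ℕ.* n) (2 ℕ.+ m))) ⟩
      (E m + β (2 ℕ.+ m) * E (2 ℕ.+ m)) + β (3 ℕ.+ m) * (E (2 ℕ.+ m) + β (4 ℕ.+ m) * E (4 ℕ.+ m))
        ≈⟨ solve 6 (λ x y z b₂ b₃ b₄ → (x :+ b₂ :* y) :+ b₃ :* (y :+ b₄ :* z)
                                         := x :+ ((b₂ :+ b₃) :* y :+ (b₃ :* b₄) :* z))
                 refl (E m) (E (2 ℕ.+ m)) (E (4 ℕ.+ m)) (β (2 ℕ.+ m)) (β (3 ℕ.+ m)) (β (4 ℕ.+ m)) ⟩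
      column (2 ℕ.+ m) (4 ℕ.+ m)
        ≡⟨ ≡.cong₂ column (ℕ.*-suc 2 l) (≡.trans (ℕ.*-suc 2 (suc l)) (≡.cong (2 ℕ.+_) (ℕ.*-suc 2 l))) ⟨
      column (2 ℕ.* suc l) (2 ℕ.* suc (suc l))
        ∎
      where
      m : ℕ
      m = 2 ℕ.* l
      E : ℕ → Carrier
      E = pathSum (2 ℕ.* n)
      -- jacobiStep evenγ evenδ (S R β n) (suc l), with the heights 2(l+1) and 2(l+2) abstracted
      column : ℕ → ℕ → Carrier
      column i j = E m + ((β (2 ℕ.+ m) + β (1 ℕ.+ i)) * E i + (β (1 ℕ.+ i) * β (2 ℕ.+ i)) * E j)

  private
    ι : ℕ → Carrier
    ι = ofℕ R

  ofℕ≡×1 : ∀ n → ofℕ R n ≡ n × 1#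
  ofℕ≡×1 zero    = ≡.refl
  ofℕ≡×1 (suc n) = ≡.cong (1# +_) (ofℕ≡×1 n)

  ofℕ-homo-+ : ∀ m n → ι (m ℕ.+ n) ≈ ι m + ι n
  ofℕ-homo-+ m n = begin
    ι (m ℕ.+ n)           ≡⟨ ofℕ≡×1 (m ℕ.+ n) ⟩
    (m ℕ.+ n) × 1#        ≈⟨ ×-homo-+ 1# m n ⟩
    m × 1# + n × 1#       ≡⟨ ≡.cong₂ _+_ (ofℕ≡×1 m) (ofℕ≡×1 n) ⟨
    ι m + ι n             ∎

  ofℕ-homo-* : ∀ m n → ι (m ℕ.* n) ≈ ι m * ι n
  ofℕ-homo-* m n = begin
    ι (m ℕ.* n)           ≡⟨ ofℕ≡×1 (m ℕ.* n) ⟩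
    (m ℕ.* n) × 1#        ≈⟨ ×1-homo-* m n ⟩
    (m × 1#) * (n × 1#)   ≡⟨ ≡.cong₂ _*_ (ofℕ≡×1 m) (ofℕ≡×1 n) ⟨
    ι m * ι n             ∎

  ofℕ-∸ : ∀ {k n} → k ≤ n → ι n ≈ ι k + ι (n ℕ.∸ k)
  ofℕ-∸ {k} {n} k≤n =
    trans (reflexive (≡.cong ι (≡.sym (ℕ.m+[n∸m]≡n k≤n)))) (ofℕ-homo-+ k (n ℕ.∸ k))

  [n∸k]*nCk≈[k+1]*nC[k+1] : ∀ n k → ι (n ℕ.∸ k) * ι (n C k) ≈ ι (suc k) * ι (n C suc k)
  [n∸k]*nCk≈[k+1]*nC[k+1] n k = begin
    ι (n ℕ.∸ k) * ι (n C k)         ≈⟨ ofℕ-homo-* (n ℕ.∸ k) (n C k) ⟨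
    ι ((n ℕ.∸ k) ℕ.* (n C k))       ≡⟨ ≡.cong ι ([n∸k]*nCk≡[k+1]*nC[k+1] n k) ⟩
    ι (suc k ℕ.* (n C suc k))       ≈⟨ ofℕ-homo-* (suc k) (n C suc k) ⟩
    ι (suc k) * ι (n C suc k)       ∎

  falling-cong : ∀ {ρ ρ′} m → ρ ≈ ρ′ → falling R ρ m ≈ falling R ρ′ m
  falling-cong zero    ρ≈ρ′ = refl
  falling-cong (suc m) ρ≈ρ′ = *-cong (falling-cong m ρ≈ρ′) (+-congʳ ρ≈ρ′)

  falling-suc-first : ∀ ρ m → falling R ρ (suc m) ≈ ρ * falling R (ρ + - 1#) m
  falling-suc-first ρ zero = begin
    1# * (ρ + - 0#)  ≈⟨ *-identityˡ _ ⟩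
    ρ + - 0#         ≈⟨ +-congˡ ε⁻¹≈ε ⟩
    ρ + 0#           ≈⟨ +-identityʳ ρ ⟩
    ρ                ≈⟨ *-identityʳ ρ ⟨
    ρ * 1#           ∎
  falling-suc-first ρ (suc m) = begin
    falling R ρ (suc m) * (ρ + - (1# + ι m))
      ≈⟨ *-cong (falling-suc-first ρ m) (+-congˡ (sym (⁻¹-∙-comm 1# (ι m)))) ⟩
    (ρ * falling R (ρ + - 1#) m) * (ρ + (- 1# + - ι m))
      ≈⟨ solve 4 (λ ρ f u v → (ρ :* f) :* (ρ :+ (u :+ v)) := ρ :* (f :* ((ρ :+ u) :+ v)))
               refl ρ (falling R (ρ + - 1#) m) (- 1#) (- ι m) ⟩
    ρ * (falling R (ρ + - 1#) m * ((ρ + - 1#) + - ι m)) ∎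

  pascal-recombine : ∀ c₀ c₁ x k q a → q * c₀ ≈ k * c₁ →
    (c₀ + c₁) * (((k + q) + a) * x) ≈ c₀ * (x * (k + a)) + ((k + (k + q)) + a) * (c₁ * x)
  pascal-recombine c₀ c₁ x k q a qc₀≈kc₁ = begin
    (c₀ + c₁) * (((k + q) + a) * x)
      ≈⟨ solve 6 (λ c₀ c₁ x k q a → (c₀ :+ c₁) :* (((k :+ q) :+ a) :* x)
                    := c₀ :* (x :* (k :+ a)) :+ ((q :* c₀) :* x :+ ((k :+ q) :+ a) :* (c₁ :* x)))
               refl c₀ c₁ x k q a ⟩
    c₀ * (x * (k + a)) + ((q * c₀) * x + ((k + q) + a) * (c₁ * x))
      ≈⟨ +-congˡ (+-congʳ (*-congʳ qc₀≈kc₁)) ⟩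
    c₀ * (x * (k + a)) + ((k * c₁) * x + ((k + q) + a) * (c₁ * x))
      ≈⟨ solve 6 (λ c₀ c₁ x k q a → c₀ :* (x :* (k :+ a)) :+ ((k :* c₁) :* x :+ ((k :+ q) :+ a) :* (c₁ :* x))
                    := c₀ :* (x :* (k :+ a)) :+ ((k :+ (k :+ q)) :+ a) :* (c₁ :* x))
               refl c₀ c₁ x k q a ⟩
    c₀ * (x * (k + a)) + ((k + (k + q)) + a) * (c₁ * x) ∎

  module _ (α : Carrier) where

    lagFalling : ℕ → ℕ → Carrier
    lagFalling n k = falling R (ι n + α) (n ℕ.∸ k)

    lagFalling-suc-row : ∀ {n k} → k ≤ n →
      lagFalling (suc n) k ≈ (ι (suc n) + α) * lagFalling n k
    lagFalling-suc-row {n} {k} k≤n rewrite ℕ.+-∸-assoc 1 k≤n = begin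
      falling R (ι (suc n) + α) (suc (n ℕ.∸ k))
        ≈⟨ falling-suc-first (ι (suc n) + α) (n ℕ.∸ k) ⟩
      (ι (suc n) + α) * falling R ((1# + ι n) + α + - 1#) (n ℕ.∸ k)
        ≈⟨ *-congˡ (falling-cong (n ℕ.∸ k)
                     (trans (+-congʳ (+-assoc 1# (ι n) α)) (xyx⁻¹≈y 1# (ι n + α)))) ⟩
      (ι (suc n) + α) * lagFalling n k ∎

    lagFalling-suc-col : ∀ {n k} → k < n →
      lagFalling n k ≈ lagFalling n (suc k) * (ι (suc k) + α)
    lagFalling-suc-col {n} {k} k<n rewrite ℕ.+-∸-assoc 1 k<n =
      *-congˡ (begin
        ι n + α + - ι d                 ≈⟨ +-congʳ (+-congʳ (ofℕ-∸ (ℕ.m∸n≤m n (suc k)))) ⟩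
        ι d + ι (n ℕ.∸ d) + α + - ι d   ≈⟨ +-congʳ (+-assoc (ι d) _ α) ⟩
        ι d + (ι (n ℕ.∸ d) + α) + - ι d ≈⟨ xyx⁻¹≈y (ι d) _ ⟩
        ι (n ℕ.∸ d) + α                 ≡⟨ ≡.cong (λ j → ι j + α) (ℕ.m∸[m∸n]≡n k<n) ⟩
        ι (suc k) + α                   ∎)
      where
      d : ℕ
      d = n ℕ.∸ suc k

    lagFalling-diag : ∀ n → lagFalling n n ≈ 1#
    lagFalling-diag n rewrite ℕ.n∸n≡0 n = refl

    lagEntry-≤ : ∀ {n k} → k ≤ n → lagEntry R α n k ≡ ι (n C k) * lagFalling n k
    lagEntry-≤ {n} {k} k≤n with k ℕ.≤? n
    ... | yes _   = ≡.refl
    ... | no  k≰n = ⊥-elim (k≰n k≤n)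

    lagEntry-> : ∀ {n k} → n < k → lagEntry R α n k ≈ 0#
    lagEntry-> {n} {k} n<k with k ℕ.≤? n
    ... | yes k≤n = ⊥-elim (ℕ.<⇒≱ n<k k≤n)
    ... | no  _   = refl

    lagEntry-diag : ∀ n → lagEntry R α n n ≈ 1#
    lagEntry-diag n = begin
      lagEntry R α n n              ≡⟨ lagEntry-≤ (ℕ.≤-refl {n}) ⟩
      ι (n C n) * lagFalling n n    ≈⟨ *-cong (reflexive (≡.cong ι (nCn≡1 n))) (lagFalling-diag n) ⟩
      (1# + 0#) * 1#                ≈⟨ *-identityʳ _ ⟩
      1# + 0#                       ≈⟨ +-identityʳ 1# ⟩
      1#                            ∎

    lagγ lagδ : ℕ → Carrier
    lagγ k = ι k + (ι (suc k) + α)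
    lagδ k = (ι (suc k) + α) * ι (suc k)

    lagEntry-absorb : ∀ n k → ι (n ℕ.∸ k) * lagEntry R α n k ≈ lagδ k * lagEntry R α n (suc k)
    lagEntry-absorb n k with ℕ.<-≤-connex k n
    ... | inj₁ k<n = begin
      Q * lagEntry R α n k          ≡⟨ ≡.cong (Q *_) (lagEntry-≤ (ℕ.<⇒≤ k<n)) ⟩
      Q * (C₀ * lagFalling n k)     ≈⟨ *-congˡ (*-congˡ (lagFalling-suc-col k<n)) ⟩
      Q * (C₀ * (X * A))            ≈⟨ sym (*-assoc Q C₀ _) ⟩
      (Q * C₀) * (X * A)            ≈⟨ *-congʳ ([n∸k]*nCk≈[k+1]*nC[k+1] n k) ⟩
      (ι (suc k) * C₁) * (X * A)    ≈⟨ solve 4 (λ K c x a → (K :* c) :* (x :* a) := (a :* K) :* (c :* x))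
                                               refl (ι (suc k)) C₁ X A ⟩
      lagδ k * (C₁ * X)             ≡⟨ ≡.cong (lagδ k *_) (lagEntry-≤ k<n) ⟨
      lagδ k * lagEntry R α n (suc k) ∎
      where
      Q C₀ C₁ X A : Carrier
      Q  = ι (n ℕ.∸ k)
      C₀ = ι (n C k)
      C₁ = ι (n C suc k)
      X  = lagFalling n (suc k)
      A  = ι (suc k) + α
    ... | inj₂ n≤k = begin
      ι (n ℕ.∸ k) * lagEntry R α n k    ≡⟨ ≡.cong (λ j → ι j * lagEntry R α n k) (ℕ.m≤n⇒m∸n≡0 n≤k) ⟩
      0# * lagEntry R α n k             ≈⟨ zeroˡ _ ⟩
      0#                                ≈⟨ zeroʳ _ ⟨
      lagδ k * 0#                       ≈⟨ *-congˡ (lagEntry-> (s≤s n≤k)) ⟨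
      lagδ k * lagEntry R α n (suc k)   ∎

    lagEntry-split : ∀ n k → (ι (k ℕ.+ suc n) + α) * lagEntry R α n k
                             ≈ lagγ k * lagEntry R α n k + lagδ k * lagEntry R α n (suc k)
    lagEntry-split n k with ℕ.≤-<-connex k n
    ... | inj₁ k≤n = begin
      (ι (k ℕ.+ suc n) + α) * L             ≈⟨ *-congʳ (+-congʳ index-split) ⟩
      ((ι k + ι (suc k)) + Q + α) * L       ≈⟨ solve 5 (λ K K₁ Q a L → ((K :+ K₁) :+ Q :+ a) :* L
                                                                   := (K :+ (K₁ :+ a)) :* L :+ Q :* L)
                                                       refl (ι k) (ι (suc k)) Q α L ⟩
      lagγ k * L + Q * L                    ≈⟨ +-congˡ (lagEntry-absorb n k) ⟩
      lagγ k * L + lagδ k * lagEntry R α n (suc k) ∎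
      where
      L Q : Carrier
      L = lagEntry R α n k
      Q = ι (n ℕ.∸ k)
      index-split : ι (k ℕ.+ suc n) ≈ (ι k + ι (suc k)) + Q
      index-split = begin
        ι (k ℕ.+ suc n)                           ≡⟨ ≡.cong (λ j → ι (k ℕ.+ suc j)) (ℕ.m+[n∸m]≡n k≤n) ⟨
        ι (k ℕ.+ (suc k ℕ.+ (n ℕ.∸ k)))           ≡⟨ ≡.cong ι (ℕ.+-assoc k (suc k) (n ℕ.∸ k)) ⟨
        ι (k ℕ.+ suc k ℕ.+ (n ℕ.∸ k))             ≈⟨ ofℕ-homo-+ (k ℕ.+ suc k) (n ℕ.∸ k) ⟩
        ι (k ℕ.+ suc k) + Q                       ≈⟨ +-congʳ (ofℕ-homo-+ k (suc k)) ⟩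
        (ι k + ι (suc k)) + Q                     ∎
    ... | inj₂ n<k = begin
      (ι (k ℕ.+ suc n) + α) * lagEntry R α n k  ≈⟨ *-congˡ (lagEntry-> n<k) ⟩
      (ι (k ℕ.+ suc n) + α) * 0#                ≈⟨ zeroʳ _ ⟩
      0#                                        ≈⟨ +-identityʳ 0# ⟨
      0# + 0#                                   ≈⟨ +-cong (zeroʳ (lagγ k)) (zeroʳ (lagδ k)) ⟨
      lagγ k * 0# + lagδ k * 0#                 ≈⟨ +-cong (*-congˡ (lagEntry-> n<k))
                                                          (*-congˡ (lagEntry-> (ℕ.m<n⇒m<1+n n<k))) ⟨
      lagγ k * lagEntry R α n k + lagδ k * lagEntry R α n (suc k) ∎

    lagEntry-suc-zero : ∀ n → lagEntry R α (suc n) 0 ≈ (ι (suc n) + α) * lagEntry R α n 0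
    lagEntry-suc-zero n = begin
      lagEntry R α (suc n) 0                         ≡⟨ lagEntry-≤ {suc n} z≤n ⟩
      ι 1 * lagFalling (suc n) 0                     ≈⟨ *-congˡ (lagFalling-suc-row {n} z≤n) ⟩
      ι 1 * ((ι (suc n) + α) * lagFalling n 0)       ≈⟨ x∙yz≈y∙xz (ι 1) (ι (suc n) + α) _ ⟩
      (ι (suc n) + α) * (ι 1 * lagFalling n 0)       ≡⟨ ≡.cong ((ι (suc n) + α) *_) (lagEntry-≤ {n} z≤n) ⟨
      (ι (suc n) + α) * lagEntry R α n 0             ∎

    lagEntry-suc-suc : ∀ n k → lagEntry R α (suc n) (suc k)
                               ≈ lagEntry R α n k + (ι (suc k ℕ.+ suc n) + α) * lagEntry R α n (suc k)
    lagEntry-suc-suc n k with ℕ.<-cmp k n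
    ... | tri< k<n _ _ = begin
      lagEntry R α (suc n) (suc k)
        ≡⟨ lagEntry-≤ (ℕ.m≤n⇒m≤1+n k<n) ⟩
      ι (suc n C suc k) * lagFalling (suc n) (suc k)
        ≈⟨ *-cong pascal (lagFalling-suc-row k<n) ⟩
      (C₀ + C₁) * ((ι (suc n) + α) * X)
        ≈⟨ *-congˡ (*-congʳ (+-congʳ ι[1+n]≈K₁+Q)) ⟩
      (C₀ + C₁) * (((K₁ + Q) + α) * X)
        ≈⟨ pascal-recombine C₀ C₁ X K₁ Q α ([n∸k]*nCk≈[k+1]*nC[k+1] n k) ⟩
      C₀ * (X * (K₁ + α)) + ((K₁ + (K₁ + Q)) + α) * (C₁ * X)
        ≈⟨ +-cong (*-congˡ (lagFalling-suc-col k<n)) (*-congʳ (+-congʳ ι[1+k+1+n]≈K₁+K₁+Q)) ⟨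
      C₀ * lagFalling n k + (ι (suc k ℕ.+ suc n) + α) * (C₁ * X)
        ≡⟨ ≡.cong₂ (λ u v → u + (ι (suc k ℕ.+ suc n) + α) * v) (lagEntry-≤ (ℕ.<⇒≤ k<n)) (lagEntry-≤ k<n) ⟨
      lagEntry R α n k + (ι (suc k ℕ.+ suc n) + α) * lagEntry R α n (suc k) ∎
      where
      C₀ C₁ X K₁ Q : Carrier
      C₀ = ι (n C k)
      C₁ = ι (n C suc k)
      X  = lagFalling n (suc k)
      K₁ = ι (suc k)
      Q  = ι (n ℕ.∸ k)
      pascal : ι (suc n C suc k) ≈ C₀ + C₁
      pascal = trans (reflexive (≡.cong ι (≡.sym (nCk+nC[k+1]≡[n+1]C[k+1] n k))))
                     (ofℕ-homo-+ (n C k) (n C suc k))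
      ι[1+n]≈K₁+Q : ι (suc n) ≈ K₁ + Q
      ι[1+n]≈K₁+Q = ofℕ-∸ (s≤s (ℕ.<⇒≤ k<n))
      ι[1+k+1+n]≈K₁+K₁+Q : ι (suc k ℕ.+ suc n) ≈ K₁ + (K₁ + Q)
      ι[1+k+1+n]≈K₁+K₁+Q = trans (ofℕ-homo-+ (suc k) (suc n)) (+-congˡ ι[1+n]≈K₁+Q)
    ... | tri≈ _ ≡.refl _ = begin
      lagEntry R α (suc n) (suc n)                                       ≈⟨ lagEntry-diag (suc n) ⟩
      1#                                                                 ≈⟨ +-identityʳ 1# ⟨
      1# + 0#                                                            ≈⟨ +-congˡ (zeroʳ _) ⟨
      1# + (ι (suc n ℕ.+ suc n) + α) * 0#
        ≈⟨ +-cong (lagEntry-diag n) (*-congˡ (lagEntry-> (ℕ.n<1+n n))) ⟨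
      lagEntry R α n n + (ι (suc n ℕ.+ suc n) + α) * lagEntry R α n (suc n) ∎
    ... | tri> _ _ n<k = begin
      lagEntry R α (suc n) (suc k)                                       ≈⟨ lagEntry-> (s≤s n<k) ⟩
      0#                                                                 ≈⟨ +-identityʳ 0# ⟨
      0# + 0#                                                            ≈⟨ +-congˡ (zeroʳ _) ⟨
      0# + (ι (suc k ℕ.+ suc n) + α) * 0#
        ≈⟨ +-cong (lagEntry-> n<k) (*-congˡ (lagEntry-> (ℕ.m<n⇒m<1+n n<k))) ⟨
      lagEntry R α n k + (ι (suc k ℕ.+ suc n) + α) * lagEntry R α n (suc k) ∎

    lagEntry-suc-jacobi : ∀ n l → lagEntry R α (suc n) l ≈ jacobiStep lagγ lagδ (lagEntry R α n) l
    lagEntry-suc-jacobi n zero    = trans (lagEntry-suc-zero n) (lagEntry-split n 0)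
    lagEntry-suc-jacobi n (suc l) = trans (lagEntry-suc-suc n l) (+-congˡ (lagEntry-split n (suc l)))

  lagEntry-row-zero : ∀ α β l → lagEntry R α 0 l ≈ S R β 0 l
  lagEntry-row-zero α β zero    = trans (lagEntry-diag α 0) (sym (+-identityʳ 1#))
  lagEntry-row-zero α β (suc l) = trans (lagEntry-> α {0} {suc l} (s≤s z≤n)) (sym (+-identityʳ 0#))

  module _ (α : Carrier) (β : ℕ → Carrier)
           (β-odd : ∀ k → β (2 ℕ.* k ℕ.+ 1) ≈ ι (suc k) + α)
           (β-even : ∀ k → β (2 ℕ.* k ℕ.+ 2) ≈ ι (suc k)) where

    private
      β[1+2k] : ∀ k → β (1 ℕ.+ 2 ℕ.* k) ≈ ι (suc k) + α
      β[1+2k] k = trans (reflexive (≡.cong β (ℕ.+-comm 1 (2 ℕ.* k)))) (β-odd k)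

      β[2+2k] : ∀ k → β (2 ℕ.+ 2 ℕ.* k) ≈ ι (suc k)
      β[2+2k] k = trans (reflexive (≡.cong β (ℕ.+-comm 2 (2 ℕ.* k)))) (β-even k)

    lagγ≈evenγ : ∀ l → lagγ α l ≈ evenγ β l
    lagγ≈evenγ zero    = trans (+-identityˡ _) (sym (β-odd 0))
    lagγ≈evenγ (suc l) = sym (+-cong (β[2+2k] l) (β[1+2k] (suc l)))

    lagδ≈evenδ : ∀ l → lagδ α l ≈ evenδ β l
    lagδ≈evenδ l = sym (*-cong (β[1+2k] l) (β[2+2k] l))

open import Data.Nat using (_*_; _+_)

proposition3p1 : {c ℓ : Level} (R : CommutativeRing c ℓ) →
    (α : CommutativeRing.Carrier R) (β : ℕ → CommutativeRing.Carrier R) →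
    (∀ k → CommutativeRing._≈_ R (β (2 * k + 1)) (CommutativeRing._+_ R (ofℕ R (suc k)) α)) →
    (∀ k → CommutativeRing._≈_ R (β (2 * k + 2)) (ofℕ R (suc k))) →
    ∀ n l → CommutativeRing._≈_ R (lagEntry R α n l) (S R β n l)
proposition3p1 R α β β-odd β-even =
  jacobiRows-unique R (lagγ≈evenγ R α β β-odd β-even) (lagδ≈evenδ R α β β-odd β-even)
    (lagEntry-row-zero R α β) (lagEntry-suc-jacobi R α) (S-suc-jacobi R β)
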